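{- Let $G$ be an infinite graph, $S$ a finite set of vertices of $G$ and $U$ an infinite set of vertices of $G$. Then $S$ does not doubly resolve $U$.
   Context: All graphs are simple, connected and locally finite. $d$ is the shortest-path distance. Two vertices $x,y$ doubly resolve a pair of vertices $u,v$ if $d(u,x)-d(v,x)\neq d(u,y)-d(v,y)$. For sets $S,U$ of vertices, $S$ doubly resolves $U$ if every pair of distinct vertices of $U$ is doubly resolved by two vertices of $S$. -}

module Defs where

open import Data.Nat using (ℕ; zero; suc; _≤_)
open import Data.Integer using (ℤ; +_; _-_)
open import Data.List using (List)
open import Data.Unit using (⊤)
open import Data.List.Membership.Propositional using (_∈_)
open import Data.Product using (Σ; ∃; _×_)
open import Relation.Nullary using (¬_)
open import Relation.Binary.PropositionalEquality using (_≡_; _≢_)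

Finite : {A : Set} → (A → Set) → Set
Finite {A} P = Σ (List A) λ xs → ∀ a → P a → a ∈ xs

Infinite : {A : Set} → (A → Set) → Set
Infinite P = ¬ Finite P

record Graph : Set₁ where
  field
    V      : Set
    _~_    : V → V → Set
    ~-sym  : ∀ {u v} → u ~ v → v ~ u
    ~-irr  : ∀ {u} → ¬ (u ~ u)

  data Walk : V → V → ℕ → Set where
    here : ∀ {u} → Walk u u zero
    step : ∀ {u w v n} → u ~ w → Walk w v n → Walk u v (suc n)

  IsDist : V → V → ℕ → Set
  IsDist u v n = Walk u v n × (∀ m → Walk u v m → n ≤ m)

  Connected : Set
  Connected = ∀ u v → ∃ λ n → Walk u v n

  LocallyFinite : Set
  LocallyFinite = ∀ u → Finite (u ~_)

  InfiniteGraph : Set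
  InfiniteGraph = Infinite {V} (λ _ → ⊤)

  DoublyResolvesPair : V → V → V → V → Set
  DoublyResolvesPair x y u v =
    ∀ a b c e → IsDist u x a → IsDist v x b → IsDist u y c → IsDist v y e →
      (+ a - + b) ≢ (+ c - + e)

  DoublyResolves : List V → (V → Set) → Set
  DoublyResolves S U =
    ∀ u v → U u → U v → u ≢ v →
      ∃ λ x → ∃ λ y → x ∈ S × y ∈ S × DoublyResolvesPair x y u v

-- Fix a base vertex b.  For x ∈ S and any vertex u the triangle inequality
-- gives |d(u,x) - d(u,b)| ≤ d(x,b), so the "offset" d(u,x) - d(u,b) of u
-- at x takes only finitely many values.  Since U is infinite and the graph
-- is locally finite, U contains vertices arbitrarily far from b; by the
-- pigeonhole principle, applied once for every x ∈ S, we find a subset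
-- Q ⊆ U, still unbounded, on which every offset is constant.  For two
-- distinct u, v ∈ Q we then get d(u,x) - d(v,x) = d(u,b) - d(v,b) for every
-- x ∈ S, so no pair x, y ∈ S doubly resolves u and v.
--
-- Adjacency is not assumed decidable, so distances exist only up to double
-- negation; since the goal is a negation we reason in the double-negation
-- monad (or in continuation-passing style) throughout.

module Submission where

open import Defs
open import Data.Empty using (⊥-elim)
open import Data.Integer as ℤ using (+_)
import Data.Integer.Properties as ℤ
import Data.Integer.Tactic.RingSolver as ℤ-Solver
open import Data.List using (List; []; _∷_; concatMap)
open import Data.List.Membership.Propositional using (_∈_; lose)
open import Data.List.Membership.Propositional.Properties using (∈-concatMap⁺)
open import Data.List.Relation.Unary.Any using (here; there)
open import Data.Nat using (ℕ; zero; suc; _+_; _∸_; _⊔_; _≤_; _<_; z≤n; s≤s)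
open import Data.Nat.Properties
open import Data.Product using (Σ; ∃; ∃₂; _×_; _,_; proj₁; proj₂)
open import Effect.Monad using (RawMonad)
open import Relation.Unary using (_⊆_)
open import Relation.Nullary using (¬_)
open import Relation.Nullary.Negation using (DoubleNegation; ¬¬-Monad)
open import Relation.Binary.PropositionalEquality

open module DoubleNegationMonad {ℓ} = RawMonad (¬¬-Monad {ℓ})

offset-difference : ∀ {e B a a' d d'} → e + d ≡ a + B → e + d' ≡ a' + B →
  + a ℤ.- + a' ≡ + d ℤ.- + d'
offset-difference {e} {B} {a} {a'} {d} {d'} eq eq' = begin
  + a ℤ.- + a'                     ≡⟨ add-right (+ a) (+ a') (+ B) ⟩
  (+ a ℤ.+ + B) ℤ.- (+ a' ℤ.+ + B)
    ≡⟨ cong₂ ℤ._-_ (embed e d a B eq) (embed e d' a' B eq') ⟩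
  (+ e ℤ.+ + d) ℤ.- (+ e ℤ.+ + d') ≡⟨ cancel-left (+ e) (+ d) (+ d') ⟩
  + d ℤ.- + d'                     ∎
  where
    open ≡-Reasoning
    add-right : ∀ x y z → x ℤ.- y ≡ (x ℤ.+ z) ℤ.- (y ℤ.+ z)
    add-right = ℤ-Solver.solve-∀
    cancel-left : ∀ z x y → (z ℤ.+ x) ℤ.- (z ℤ.+ y) ≡ x ℤ.- y
    cancel-left = ℤ-Solver.solve-∀
    embed : ∀ m n p q → m + n ≡ p + q → + p ℤ.+ + q ≡ + m ℤ.+ + n
    embed m n p q h =
      trans (sym (ℤ.pos-+ p q)) (trans (cong +_ (sym h)) (ℤ.pos-+ m n))

offset-bound : ∀ {dₓ} d₀ B → dₓ ≤ d₀ + B → dₓ + B ∸ d₀ < suc (B + B)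
offset-bound {dₓ} d₀ B dₓ≤ = s≤s (begin
  dₓ + B ∸ d₀        ≤⟨ ∸-monoˡ-≤ d₀ (+-monoˡ-≤ B dₓ≤) ⟩
  d₀ + B + B ∸ d₀    ≡⟨ cong (_∸ d₀) (+-assoc d₀ B B) ⟩
  d₀ + (B + B) ∸ d₀  ≡⟨ m+n∸m≡n d₀ (B + B) ⟩
  B + B              ∎)
  where open ≤-Reasoning

infinite-inhabited : {A : Set} {U : A → Set} → Infinite U → DoubleNegation (∃ U)
infinite-inhabited inf none = inf ([] , λ a Ua → ⊥-elim (none (a , Ua)))

-- Unboundedness with respect to a height function is the constructive
-- stand-in for infinitude: its witnesses are separated from a finite part by
-- the decidable test N < height u rather than by (non-)membership in a list.
module Heights {A : Set} (height : A → ℕ) where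

  Unbounded : (A → Set) → Set
  Unbounded P = ∀ N → DoubleNegation (∃ λ u → P u × N < height u)

  unbounded-mono : {P Q : A → Set} → P ⊆ Q → Unbounded P → Unbounded Q
  unbounded-mono P⊆Q unb N = do
    (u , Pu , N<h) ← unb N
    return (u , P⊆Q Pu , N<h)

  unbounded-above : ∀ {P} N₀ → Unbounded P → Unbounded (λ u → P u × N₀ < height u)
  unbounded-above N₀ unb N = do
    (u , Pu , N⊔N₀<h) ← unb (N ⊔ N₀)
    return (u , (Pu , ≤-<-trans (m≤n⊔m N N₀) N⊔N₀<h) , ≤-<-trans (m≤m⊔n N N₀) N⊔N₀<h)

  not-unbounded : ∀ {P} → ¬ Unbounded P → DoubleNegation (∃ λ N → ∀ u → P u → height u ≤ N)
  not-unbounded ¬unb bounded =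
    ¬unb (λ N high → bounded (N , λ u Pu → ≮⇒≥ (λ N<h → high (u , Pu , N<h))))

  pigeonhole : ∀ M P (R : A → ℕ → Set) → Unbounded P →
    (∀ u → P u → DoubleNegation (∃ λ e → e < M × R u e)) →
    DoubleNegation (∃ λ e → Unbounded (λ u → P u × R u e))
  pigeonhole zero P R unb colour none = unb 0 λ (u , Pu , _) → colour u Pu λ ()
  pigeonhole (suc M) P R unb colour none =
    not-unbounded (λ unb-M → none (M , unb-M)) λ (N₀ , bound) →
    pigeonhole M _ R (unbounded-above N₀ unb) (fewer-colours bound)
      λ (e , unb-e) → none (e , unbounded-mono (λ ((Pu , _) , r) → Pu , r) unb-e)
    where
      -- Above the bound of the last colour class, only M colours occur.
      fewer-colours : ∀ {N₀} → (∀ u → P u × R u M → height u ≤ N₀) →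
        ∀ u → P u × N₀ < height u → DoubleNegation (∃ λ e → e < M × R u e)
      fewer-colours bound u (Pu , above) = do
        (e , e<1+M , r) ← colour u Pu
        let e≢M : e ≢ M
            e≢M = λ { refl → <⇒≱ above (bound u (Pu , r)) }
        return (e , ≤∧≢⇒< (≤-pred e<1+M) e≢M , r)

  Monochromatic : {X : Set} → (X → A → ℕ → Set) → List X → (A → Set) → Set
  Monochromatic R T Q = ∀ x → x ∈ T → ∃ λ e → ∀ u → Q u → R x u e

  monochromatic-refinement : {X : Set} (R : X → A → ℕ → Set) (colours : X → ℕ) →
    (∀ x u → DoubleNegation (∃ λ e → e < colours x × R x u e)) →
    ∀ T P → Unbounded P →
    DoubleNegation (Σ (A → Set) λ Q → Unbounded Q × Q ⊆ P × Monochromatic R T Q)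
  monochromatic-refinement R colours colour [] P unb found =
    found (P , unb , (λ {u} Pu → Pu) , λ _ ())
  monochromatic-refinement R colours colour (x ∷ T) P unb found =
    pigeonhole (colours x) P (R x) unb (λ u _ → colour x u) λ (e , unb-e) →
    monochromatic-refinement R colours colour T _ unb-e λ (Q , unb-Q , Q⊆ , mono) →
    found (Q , unb-Q , (λ Qu → proj₁ (Q⊆ Qu)) , λ
      { .x (here refl) → e , λ u Qu → proj₂ (Q⊆ Qu)
      ; y  (there y∈T) → mono y y∈T })

  two-distinct : ∀ {Q} → Unbounded Q → DoubleNegation (∃₂ λ u v → Q u × Q v × u ≢ v)
  two-distinct unb = do
    (u , Qu , _)    ← unb 0
    (v , Qv , hu<hv) ← unb (height u)
    return (u , v , Qu , Qv , λ { refl → <-irrefl refl hu<hv })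

module GraphFacts (G : Graph) where
  open Graph G

  _++ʷ_ : ∀ {u v w m n} → Walk u v m → Walk v w n → Walk u w (m + n)
  here       ++ʷ q = q
  step e p   ++ʷ q = step e (p ++ʷ q)

  dist-unique : ∀ {u x n n'} → IsDist u x n → IsDist u x n' → n ≡ n'
  dist-unique (p , p-min) (q , q-min) = ≤-antisym (p-min _ q) (q-min _ p)

  dist-triangle : ∀ {u v w d m n} → IsDist u w d → Walk u v m → Walk v w n → d ≤ m + n
  dist-triangle (_ , minimal) p q = minimal _ (p ++ʷ q)

  -- A walk of length m ≤ bound yields a shortest walk, by a search of
  -- depth `bound` for strictly shorter walks.
  shortest-below : ∀ {u x} bound m → m ≤ bound → Walk u x m →
    DoubleNegation (∃ λ n → IsDist u x n)
  shortest-below zero      .zero z≤n p none = none (zero , p , λ _ _ → z≤n)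
  shortest-below (suc bound) m m≤ p none =
    none (m , p , λ m' p' → ≮⇒≥ λ m'<m →
      shortest-below bound m' (≤-pred (≤-trans m'<m m≤)) p' none)

  distance : Connected → ∀ u x → DoubleNegation (∃ λ n → IsDist u x n)
  distance conn u x = shortest-below _ _ ≤-refl (proj₂ (conn u x))

  module LocallyFiniteBalls (lf : LocallyFinite) where

    closed-neighbourhood : V → List V
    closed-neighbourhood w = w ∷ proj₁ (lf w)

    Ball : V → ℕ → List V
    Ball b zero    = b ∷ []
    Ball b (suc N) = concatMap closed-neighbourhood (Ball b N)

    walk-in-ball : ∀ {b v n} N → Walk v b n → n ≤ N → v ∈ Ball b N
    walk-in-ball zero    here       z≤n      = here refl
    walk-in-ball (suc N) here       _        =
      ∈-concatMap⁺ closed-neighbourhood (lose (walk-in-ball N here z≤n) (here refl))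
    walk-in-ball (suc N) (step {v} {w} v~w p) (s≤s n≤N) =
      ∈-concatMap⁺ closed-neighbourhood
        (lose (walk-in-ball N p n≤N) (there (proj₂ (lf w) v (~-sym v~w))))

  module Offsets (conn : Connected) (lf : LocallyFinite) (b : V) where
    open LocallyFiniteBalls lf

    height : V → ℕ
    height u = proj₁ (conn u b)

    open Heights height

    infinite⇒unbounded : ∀ {U} → Infinite U → Unbounded U
    infinite⇒unbounded inf N low = inf (Ball b N , λ u Uu →
      walk-in-ball N (proj₂ (conn u b)) (≮⇒≥ λ N<h → low (u , Uu , N<h)))

    -- Length of a closed walk x → b → x; bounds |d(u,x) - d(u,b)|.
    detour : V → ℕ
    detour x = proj₁ (conn x b) + proj₁ (conn b x)

    Offset : V → V → ℕ → Set
    Offset x u e = ∃₂ λ d₀ dₓ → IsDist u b d₀ × IsDist u x dₓ × e + d₀ ≡ dₓ + detour x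

    offset-exists : ∀ x u →
      DoubleNegation (∃ λ e → e < suc (detour x + detour x) × Offset x u e)
    offset-exists x u = do
      (d₀ , d₀-dist) ← distance conn u b
      (dₓ , dₓ-dist) ← distance conn u x
      let d₀≤ : d₀ ≤ dₓ + detour x
          d₀≤ = ≤-trans (dist-triangle d₀-dist (proj₁ dₓ-dist) (proj₂ (conn x b)))
                        (+-monoʳ-≤ dₓ (m≤m+n _ _))
          dₓ≤ : dₓ ≤ d₀ + detour x
          dₓ≤ = ≤-trans (dist-triangle dₓ-dist (proj₁ d₀-dist) (proj₂ (conn b x)))
                        (+-monoʳ-≤ d₀ (m≤n+m _ _))
      return (dₓ + detour x ∸ d₀ , offset-bound d₀ (detour x) dₓ≤ ,
              d₀ , dₓ , d₀-dist , dₓ-dist , m∸n+n≡m d₀≤)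

    equal-offsets : ∀ {x u v e a a' d d'} → Offset x u e → Offset x v e →
      IsDist u x a → IsDist v x a' → IsDist u b d → IsDist v b d' →
      + a ℤ.- + a' ≡ + d ℤ.- + d'
    equal-offsets {x} {e = e} (d₀ , dₓ , u-b , u-x , eq) (d₀' , dₓ' , v-b , v-x , eq')
                  a-dist a'-dist d-dist d'-dist
      rewrite dist-unique a-dist u-x | dist-unique a'-dist v-x
            | dist-unique d-dist u-b | dist-unique d'-dist v-b
      = offset-difference {e} {detour x} {dₓ} {dₓ'} eq eq'

    equal-offsets-unresolved : ∀ {x y u v} →
      (∃ λ e → Offset x u e × Offset x v e) → (∃ λ e → Offset y u e × Offset y v e) →
      ¬ DoublyResolvesPair x y u v
    equal-offsets-unresolved
      (_ , offs-x-u@(_ , _ , u-b , u-x , _) , offs-x-v@(_ , _ , v-b , v-x , _))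
      (_ , offs-y-u@(_ , _ , _ , u-y , _) , offs-y-v@(_ , _ , _ , v-y , _))
      resolves =
      resolves _ _ _ _ u-x v-x u-y v-y (trans
        (equal-offsets offs-x-u offs-x-v u-x v-x u-b v-b)
        (sym (equal-offsets offs-y-u offs-y-v u-y v-y u-b v-b)))

    not-doubly-resolving : ∀ S {U} → Infinite U → ¬ DoublyResolves S U
    not-doubly-resolving S inf resolves =
      monochromatic-refinement Offset (λ x → suc (detour x + detour x)) offset-exists
        S _ (infinite⇒unbounded inf) λ (Q , unb-Q , Q⊆U , mono) →
      two-distinct unb-Q λ (u , v , Qu , Qv , u≢v) →
      let (x , y , x∈S , y∈S , x,y-resolve) = resolves u v (Q⊆U Qu) (Q⊆U Qv) u≢v
          shared : ∀ z → z ∈ S → ∃ λ e → Offset z u e × Offset z v e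
          shared z z∈S = let (e , all-e) = mono z z∈S in e , all-e u Qu , all-e v Qv
      in equal-offsets-unresolved (shared x x∈S) (shared y y∈S) x,y-resolve

lemma5 : (G : Graph) → Graph.Connected G → Graph.LocallyFinite G → Graph.InfiniteGraph G →
    (S : List (Graph.V G)) (U : Graph.V G → Set) → Infinite U →
    ¬ Graph.DoublyResolves G S U
lemma5 G conn lf _ S U inf resolves = infinite-inhabited inf λ (b , _) →
  GraphFacts.Offsets.not-doubly-resolving G conn lf b S inf resolves
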